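{- Let $G$ be a finite simple graph, $r\ge1$ an integer and $H$ an induced subgraph of $G$. If $\chi_r(G)=\chi_r(G\setminus H)+\chi_r(H)$, then $\iota_r(G)\ge\iota_r(G\setminus H)+\iota_r(H)$.
   Context: $G\setminus H$ is the subgraph induced on $V(G)\setminus V(H)$. An $r$-bounded coloring is a proper coloring whose color classes each have at most $r$ vertices; $\chi_r(\cdot)$ is the minimum number of classes in an $r$-bounded coloring, and such a minimum coloring is called an optimal $r$-bounded coloring. $\iota_r(\cdot)$ is the maximum number of singleton color classes in an optimal $r$-bounded coloring. -}

module Defs where

open import Data.Nat using (ℕ; _≤_; _≟_)
open import Data.Fin using (Fin)
import Data.Fin.Properties as FinP
open import Data.Bool using (Bool; not; T)
open import Data.List using (List; length; filter; lookup; allFin)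
open import Data.Product using (Σ; ∃; _×_; _,_)
open import Relation.Nullary using (¬_)
open import Relation.Binary.PropositionalEquality using (_≡_; _≢_)
open import Function.Definitions using (Surjective)
open import Relation.Nullary.Decidable using (T?)

record Graph (n : ℕ) : Set₁ where
  field
    Adj    : Fin n → Fin n → Set
    sym    : ∀ {u v} → Adj u v → Adj v u
    irrefl : ∀ {v} → ¬ Adj v v
open Graph public

induceOn : ∀ {n} (G : Graph n) (L : List (Fin n)) → Graph (length L)
induceOn G L = record
  { Adj = λ i j → Adj G (lookup L i) (lookup L j)
  ; sym = sym G
  ; irrefl = irrefl G }

verticesIn : ∀ {n} → (Fin n → Bool) → List (Fin n)
verticesIn {n} S = filter (λ v → T? (S v)) (allFin n)

-- H = G[S] (induced subgraph on S) and G \ H = G[V(G) \ S].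
induced : ∀ {n} (G : Graph n) (S : Fin n → Bool) → Graph (length (verticesIn S))
induced G S = induceOn G (verticesIn S)

minus : ∀ {n} (G : Graph n) (S : Fin n → Bool) →
        Graph (length (verticesIn (λ v → not (S v))))
minus G S = induced G (λ v → not (S v))

classSize : ∀ {n k} → (Fin n → Fin k) → Fin k → ℕ
classSize {n} c j = length (filter (λ v → c v FinP.≟ j) (allFin n))

singletons : ∀ {n k} → (Fin n → Fin k) → ℕ
singletons {k = k} c = length (filter (λ j → classSize c j ≟ 1) (allFin k))

record BoundedColoring {n} (G : Graph n) (r k : ℕ) : Set where
  field
    col     : Fin n → Fin k
    onto    : Surjective _≡_ _≡_ col
    proper  : ∀ {u v} → Adj G u v → col u ≢ col v
    bounded : ∀ j → classSize col j ≤ r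
open BoundedColoring public

IsChi : ∀ {n} → Graph n → ℕ → ℕ → Set
IsChi G r k = BoundedColoring G r k × (∀ m → BoundedColoring G r m → k ≤ m)

IsIota : ∀ {n} → Graph n → ℕ → ℕ → Set
IsIota G r i = Σ ℕ λ k → IsChi G r k ×
  (Σ (BoundedColoring G r k) (λ c → singletons (col c) ≡ i)) ×
  (∀ (c : BoundedColoring G r k) → singletons (col c) ≤ i)

-- Colour G ∖ H and H optimally with disjoint palettes: the union is an r-bounded colouring of G
-- with χ_r(G ∖ H) + χ_r(H) = χ_r(G) colours, hence optimal, and its colour classes are exactly
-- those of the two pieces, so it has ι_r(G ∖ H) + ι_r(H) singleton classes.

module Submission where

open import Defs hiding (sym)
import Data.Fin.Properties as FinP
open import Data.Bool using (Bool; true; false; not; T)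
open import Data.Bool.Properties using (T-≡; T-not-≡)
open import Data.Empty using (⊥-elim)
open import Data.Fin using (Fin; zero; suc; _↑ˡ_; _↑ʳ_; splitAt; join)
open import Data.List using (List; []; _∷_; length; filter; lookup; allFin; map; tabulate; _++_)
open import Data.List.Properties using (length-++; filter-++; filter-≐; filter-none; map-tabulate; tabulate-lookup)
open import Data.List.Membership.Propositional using (_∈_)
open import Data.List.Membership.Propositional.Properties using (∈-filter⁺; ∈-filter⁻; ∈-allFin; ∈-lookup)
import Data.List.Relation.Unary.All as All
open import Data.List.Relation.Unary.AllPairs using ([]; _∷_)
open import Data.List.Relation.Unary.Any using (index)
open import Data.List.Relation.Unary.Any.Properties using (lookup-index)
open import Data.List.Relation.Unary.Unique.Propositional using (Unique)
open import Data.List.Relation.Unary.Unique.Propositional.Properties using (filter⁺; allFin⁺)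
open import Data.Nat using (ℕ; zero; suc; _+_; _≤_; _≥_; _≟_)
open import Data.Nat.Properties using (+-suc; +-identityʳ; ≤-antisym; module ≤-Reasoning)
open import Data.Product using (∃; _,_; proj₂)
open import Data.Sum using (_⊎_; inj₁; inj₂; [_,_]′)
import Data.Sum as Sum
open import Data.Sum.Properties using (inj₁-injective; inj₂-injective)
open import Function using (_∘_; id; Injective)
open import Function.Bundles using (Equivalence)
open import Function.Consequences.Propositional using (strictlySurjective⇒surjective)
open import Relation.Binary.PropositionalEquality
open import Relation.Binary.Definitions using (DecidableEquality)
open import Relation.Nullary using (¬_; yes; no)
open import Relation.Nullary.Decidable using (T?)
open import Relation.Unary using (Pred; Decidable; _≐_)

count : ∀ {a p} {A : Set a} {P : Pred A p} → Decidable P → List A → ℕ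
count P? xs = length (filter P? xs)

module _ {a p} {A : Set a} {P : Pred A p} (P? : Decidable P) where

  count-++ : ∀ xs ys → count P? (xs ++ ys) ≡ count P? xs + count P? ys
  count-++ xs ys = trans (cong length (filter-++ P? xs ys)) (length-++ (filter P? xs))

  count-map : ∀ {b} {B : Set b} (f : B → A) xs → count P? (map f xs) ≡ count (λ x → P? (f x)) xs
  count-map f [] = refl
  count-map f (x ∷ xs) with P? (f x)
  ... | yes _ = cong suc (count-map f xs)
  ... | no _ = count-map f xs

  count-none : (∀ x → ¬ P x) → ∀ xs → count P? xs ≡ 0
  count-none ¬P xs = cong length (filter-none P? (All.universal ¬P xs))

  count-partition : ∀ (S : A → Bool) xs →
    count P? xs ≡ count P? (filter (λ x → T? (not (S x))) xs) + count P? (filter (λ x → T? (S x)) xs)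
  count-partition S [] = refl
  count-partition S (x ∷ xs) with S x
  ... | false with P? x
  ...   | yes _ = cong suc (count-partition S xs)
  ...   | no _ = count-partition S xs
  count-partition S (x ∷ xs) | true with P? x
  ...   | yes _ = trans (cong suc (count-partition S xs)) (sym (+-suc _ _))
  ...   | no _ = count-partition S xs

  count-tabulate : ∀ {m} (f : Fin m → A) → count P? (tabulate f) ≡ count (λ i → P? (f i)) (allFin m)
  count-tabulate f = trans (cong (count P?) (sym (map-tabulate id f))) (count-map f (allFin _))

  count-lookup : ∀ xs → count P? xs ≡ count (λ i → P? (lookup xs i)) (allFin (length xs))
  count-lookup xs = trans (cong (count P?) (sym (tabulate-lookup xs))) (count-tabulate (lookup xs))

count-≐ : ∀ {a p q} {A : Set a} {P : Pred A p} {Q : Pred A q} (P? : Decidable P) (Q? : Decidable Q) →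
  P ≐ Q → ∀ xs → count P? xs ≡ count Q? xs
count-≐ P? Q? P≐Q xs = cong length (filter-≐ P? Q? P≐Q xs)

count-≗ : ∀ {a b} {A : Set a} {B : Set b} (_≟ᴮ_ : DecidableEquality B) {f g : A → B} →
  (∀ x → f x ≡ g x) → ∀ y xs → count (λ x → f x ≟ᴮ y) xs ≡ count (λ x → g x ≟ᴮ y) xs
count-≗ _≟ᴮ_ f≗g y = count-≐ _ _ ((λ {x} → trans (sym (f≗g x))) , (λ {x} → trans (f≗g x)))

tabulate-+ : ∀ {a} {A : Set a} m {n} (f : Fin (m + n) → A) →
  tabulate f ≡ tabulate (λ i → f (i ↑ˡ n)) ++ tabulate (λ i → f (m ↑ʳ i))
tabulate-+ zero f = refl
tabulate-+ (suc m) f = cong (f zero ∷_) (tabulate-+ m (f ∘ suc))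

count-allFin-+ : ∀ {p} m {n} {P : Pred (Fin (m + n)) p} (P? : Decidable P) →
  count P? (allFin (m + n)) ≡ count (λ i → P? (i ↑ˡ n)) (allFin m) + count (λ i → P? (m ↑ʳ i)) (allFin n)
count-allFin-+ m {n} P? = begin
  count P? (allFin (m + n))                                        ≡⟨ cong (count P?) (tabulate-+ m id) ⟩
  count P? (tabulate (_↑ˡ n) ++ tabulate (m ↑ʳ_))                  ≡⟨ count-++ P? (tabulate (_↑ˡ n)) _ ⟩
  count P? (tabulate (_↑ˡ n)) + count P? (tabulate (m ↑ʳ_))        ≡⟨ cong₂ _+_ (count-tabulate P? (_↑ˡ n)) (count-tabulate P? (m ↑ʳ_)) ⟩
  count (λ i → P? (i ↑ˡ n)) (allFin m) + count (λ i → P? (m ↑ʳ i)) (allFin n) ∎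
  where open ≡-Reasoning

lookup-injective : ∀ {a} {A : Set a} {xs : List A} → Unique xs → ∀ i j → lookup xs i ≡ lookup xs j → i ≡ j
lookup-injective (_ ∷ _) zero zero _ = refl
lookup-injective (x∉ ∷ _) zero (suc j) eq = ⊥-elim (All.lookup x∉ (∈-lookup j) eq)
lookup-injective (x∉ ∷ _) (suc i) zero eq = ⊥-elim (All.lookup x∉ (∈-lookup i) (sym eq))
lookup-injective (_ ∷ u) (suc i) (suc j) eq = cong suc (lookup-injective u i j eq)

index-lookup : ∀ {a} {A : Set a} {xs : List A} → Unique xs → ∀ i (p : lookup xs i ∈ xs) → index p ≡ i
index-lookup u i p = lookup-injective u _ _ (sym (lookup-index p))

module _ {n} (S : Fin n → Bool) where

  ∈-verticesIn⁺ : ∀ {v} → T (S v) → v ∈ verticesIn S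
  ∈-verticesIn⁺ {v} = ∈-filter⁺ (λ v → T? (S v)) (∈-allFin v)

  ∈-verticesIn⁻ : ∀ {v} → v ∈ verticesIn S → T (S v)
  ∈-verticesIn⁻ v∈ = proj₂ (∈-filter⁻ (λ v → T? (S v)) {xs = allFin n} v∈)

  verticesIn-unique : Unique (verticesIn S)
  verticesIn-unique = filter⁺ (λ v → T? (S v)) (allFin⁺ n)

module VertexPartition {n} (S : Fin n → Bool) where

  Outside Inside : List (Fin n)
  Outside = verticesIn (λ v → not (S v))
  Inside = verticesIn S

  -- Splitting on S v through an explicit equation lets position (lookup Outside i) be computed.
  locate : ∀ v b → S v ≡ b → Fin (length Outside) ⊎ Fin (length Inside)
  locate v false e = inj₁ (index (∈-verticesIn⁺ (not ∘ S) (Equivalence.from T-not-≡ e)))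
  locate v true e = inj₂ (index (∈-verticesIn⁺ S (Equivalence.from T-≡ e)))

  position : Fin n → Fin (length Outside) ⊎ Fin (length Inside)
  position v = locate v (S v) refl

  vertexAt : Fin (length Outside) ⊎ Fin (length Inside) → Fin n
  vertexAt = [ lookup Outside , lookup Inside ]′

  vertexAt-position : ∀ v → vertexAt (position v) ≡ v
  vertexAt-position v = go (S v) refl
    where
    go : ∀ b (e : S v ≡ b) → vertexAt (locate v b e) ≡ v
    go false e = sym (lookup-index (∈-verticesIn⁺ (not ∘ S) (Equivalence.from T-not-≡ e)))
    go true e = sym (lookup-index (∈-verticesIn⁺ S (Equivalence.from T-≡ e)))

  position-vertexAt : ∀ p → position (vertexAt p) ≡ p
  position-vertexAt (inj₁ i) = go (S (lookup Outside i)) refl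
    where
    go : ∀ b (e : S (lookup Outside i) ≡ b) → locate (lookup Outside i) b e ≡ inj₁ i
    go false e = cong inj₁ (index-lookup (verticesIn-unique (not ∘ S)) i _)
    go true e = ⊥-elim (subst (T ∘ not) e (∈-verticesIn⁻ (not ∘ S) (∈-lookup i)))
  position-vertexAt (inj₂ i) = go (S (lookup Inside i)) refl
    where
    go : ∀ b (e : S (lookup Inside i) ≡ b) → locate (lookup Inside i) b e ≡ inj₂ i
    go false e = ⊥-elim (subst T e (∈-verticesIn⁻ S (∈-lookup i)))
    go true e = cong inj₂ (index-lookup (verticesIn-unique S) i _)

  count-vertices : ∀ {p} {P : Pred (Fin n) p} (P? : Decidable P) →
    count P? (allFin n) ≡
      count (λ i → P? (lookup Outside i)) (allFin (length Outside)) +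
      count (λ i → P? (lookup Inside i)) (allFin (length Inside))
  count-vertices P? =
    trans (count-partition P? S (allFin n)) (cong₂ _+_ (count-lookup P? Outside) (count-lookup P? Inside))

classSize-∘-injective : ∀ {n k l} {f : Fin k → Fin l} → Injective _≡_ _≡_ f →
  (c : Fin n → Fin k) → ∀ j → classSize (f ∘ c) (f j) ≡ classSize c j
classSize-∘-injective {n} f-inj c j = count-≐ _ _ (f-inj , cong _) (allFin n)

classSize-absent : ∀ {n k} (c : Fin n → Fin k) {j} → (∀ v → c v ≢ j) → classSize c j ≡ 0
classSize-absent {n} c absent = count-none _ absent (allFin n)

join-injective : ∀ m n → Injective _≡_ _≡_ (join m n)
join-injective m n {x} {y} eq =
  trans (sym (FinP.splitAt-join m n x)) (trans (cong (splitAt m) eq) (FinP.splitAt-join m n y))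

↑ˡ≢↑ʳ : ∀ {m n} (i : Fin m) (j : Fin n) → i ↑ˡ n ≢ m ↑ʳ j
↑ˡ≢↑ʳ {m} {n} i j eq with join-injective m n {inj₁ i} {inj₂ j} eq
... | ()

join-elim : ∀ {p} m n (P : Fin (m + n) → Set p) → (∀ x → P (join m n x)) → ∀ i → P i
join-elim m n P P-join i = subst P (FinP.join-splitAt m n i) (P-join (splitAt m i))

IsChi-unique : ∀ {n} {G : Graph n} {r k k′} → IsChi G r k → IsChi G r k′ → k ≡ k′
IsChi-unique (c , minimal) (c′ , minimal′) = ≤-antisym (minimal _ c′) (minimal′ _ c)

singletons≤ι : ∀ {n} {G : Graph n} {r i k} → IsIota G r i → IsChi G r k →
  (c : BoundedColoring G r k) → singletons (col c) ≤ i
singletons≤ι (_ , χ′ , _ , maximal) χ c with IsChi-unique χ′ χ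
... | refl = maximal c

module Glue {n} (G : Graph n) (r : ℕ) (S : Fin n → Bool) {k₁ k₂}
  (C₁ : BoundedColoring (minus G S) r k₁) (C₂ : BoundedColoring (induced G S) r k₂) where

  open VertexPartition S

  c₁ : Fin (length Outside) → Fin k₁
  c₁ = col C₁

  c₂ : Fin (length Inside) → Fin k₂
  c₂ = col C₂

  colour : Fin n → Fin (k₁ + k₂)
  colour = join k₁ k₂ ∘ Sum.map c₁ c₂ ∘ position

  colour-vertexAt : ∀ p → colour (vertexAt p) ≡ join k₁ k₂ (Sum.map c₁ c₂ p)
  colour-vertexAt p = cong (join k₁ k₂ ∘ Sum.map c₁ c₂) (position-vertexAt p)

  classSize-colour : ∀ t → classSize colour t ≡ classSize ((_↑ˡ k₂) ∘ c₁) t + classSize ((k₁ ↑ʳ_) ∘ c₂) t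
  classSize-colour t = trans (count-vertices (λ v → colour v FinP.≟ t))
    (cong₂ _+_ (count-≗ FinP._≟_ (colour-vertexAt ∘ inj₁) t (allFin _))
               (count-≗ FinP._≟_ (colour-vertexAt ∘ inj₂) t (allFin _)))

  classSize-join : ∀ p → classSize colour (join k₁ k₂ p) ≡ [ classSize c₁ , classSize c₂ ]′ p
  classSize-join (inj₁ j) = begin
    classSize colour (j ↑ˡ k₂)                                             ≡⟨ classSize-colour _ ⟩
    classSize ((_↑ˡ k₂) ∘ c₁) (j ↑ˡ k₂) + classSize ((k₁ ↑ʳ_) ∘ c₂) (j ↑ˡ k₂) ≡⟨ cong₂ _+_
      (classSize-∘-injective (FinP.↑ˡ-injective k₂ _ _) c₁ j)
      (classSize-absent ((k₁ ↑ʳ_) ∘ c₂) (λ v → ↑ˡ≢↑ʳ j (c₂ v) ∘ sym)) ⟩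
    classSize c₁ j + 0                                                     ≡⟨ +-identityʳ _ ⟩
    classSize c₁ j                                                         ∎
    where open ≡-Reasoning
  classSize-join (inj₂ j) = begin
    classSize colour (k₁ ↑ʳ j)                                             ≡⟨ classSize-colour _ ⟩
    classSize ((_↑ˡ k₂) ∘ c₁) (k₁ ↑ʳ j) + classSize ((k₁ ↑ʳ_) ∘ c₂) (k₁ ↑ʳ j) ≡⟨ cong₂ _+_
      (classSize-absent ((_↑ˡ k₂) ∘ c₁) (λ v → ↑ˡ≢↑ʳ (c₁ v) j))
      (classSize-∘-injective (FinP.↑ʳ-injective k₁ _ _) c₂ j) ⟩
    classSize c₂ j                                                         ∎
    where open ≡-Reasoning

  proper-vertexAt : ∀ p q → Adj G (vertexAt p) (vertexAt q) →
    join k₁ k₂ (Sum.map c₁ c₂ p) ≢ join k₁ k₂ (Sum.map c₁ c₂ q)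
  proper-vertexAt (inj₁ i) (inj₁ j) adj eq = proper C₁ adj (inj₁-injective (join-injective k₁ k₂ eq))
  proper-vertexAt (inj₂ i) (inj₂ j) adj eq = proper C₂ adj (inj₂-injective (join-injective k₁ k₂ eq))
  proper-vertexAt (inj₁ i) (inj₂ j) _ eq = ↑ˡ≢↑ʳ (c₁ i) (c₂ j) eq
  proper-vertexAt (inj₂ i) (inj₁ j) _ eq = ↑ˡ≢↑ʳ (c₁ j) (c₂ i) (sym eq)

  colour-proper : ∀ {u v} → Adj G u v → colour u ≢ colour v
  colour-proper {u} {v} adj = proper-vertexAt (position u) (position v)
    (subst₂ (Adj G) (sym (vertexAt-position u)) (sym (vertexAt-position v)) adj)

  colour-hits-join : ∀ p → ∃ λ v → colour v ≡ join k₁ k₂ p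
  colour-hits-join (inj₁ j) with onto C₁ j
  ... | i , c₁i≡j = vertexAt (inj₁ i) , trans (colour-vertexAt (inj₁ i)) (cong (_↑ˡ k₂) (c₁i≡j refl))
  colour-hits-join (inj₂ j) with onto C₂ j
  ... | i , c₂i≡j = vertexAt (inj₂ i) , trans (colour-vertexAt (inj₂ i)) (cong (k₁ ↑ʳ_) (c₂i≡j refl))

  classSize-join-bounded : ∀ p → classSize colour (join k₁ k₂ p) ≤ r
  classSize-join-bounded (inj₁ j) = subst (_≤ r) (sym (classSize-join (inj₁ j))) (bounded C₁ j)
  classSize-join-bounded (inj₂ j) = subst (_≤ r) (sym (classSize-join (inj₂ j))) (bounded C₂ j)

  glued : BoundedColoring G r (k₁ + k₂)
  glued = record
    { col = colour
    ; onto = strictlySurjective⇒surjective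
        (join-elim k₁ k₂ (λ t → ∃ λ v → colour v ≡ t) colour-hits-join)
    ; proper = colour-proper
    ; bounded = join-elim k₁ k₂ (λ t → classSize colour t ≤ r) classSize-join-bounded
    }

  singletons-glued : singletons colour ≡ singletons c₁ + singletons c₂
  singletons-glued = trans (count-allFin-+ k₁ (λ t → classSize colour t ≟ 1))
    (cong₂ _+_ (count-≗ _≟_ (classSize-join ∘ inj₁) 1 (allFin k₁))
               (count-≗ _≟_ (classSize-join ∘ inj₂) 1 (allFin k₂)))

lemma6p12 : ∀ {n} (G : Graph n) (r : ℕ) → r ≥ 1 → (S : Fin n → Bool) →
    ∀ {χG χGH χH ιG ιGH ιH : ℕ} →
    IsChi G r χG → IsChi (minus G S) r χGH → IsChi (induced G S) r χH →
    χG ≡ χGH + χH →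
    IsIota G r ιG → IsIota (minus G S) r ιGH → IsIota (induced G S) r ιH →
    ιG ≥ ιGH + ιH
lemma6p12 G r _ S {ιG = ιG} {ιGH} {ιH} χG χGH χH χ-additive ιG-optimal
  (k₁ , χk₁ , (C₁ , ιGH-attained) , _) (k₂ , χk₂ , (C₂ , ιH-attained) , _) = begin
    ιGH + ιH                      ≡⟨ cong₂ _+_ (sym ιGH-attained) (sym ιH-attained) ⟩
    singletons c₁ + singletons c₂ ≡⟨ sym singletons-glued ⟩
    singletons colour             ≤⟨ singletons≤ι ιG-optimal glued-optimal glued ⟩
    ιG                            ∎
  where
  open Glue G r S C₁ C₂
  open ≤-Reasoning
  glued-optimal : IsChi G r (k₁ + k₂)
  glued-optimal = subst (IsChi G r)
    (trans χ-additive (cong₂ _+_ (IsChi-unique χGH χk₁) (IsChi-unique χH χk₂))) χG
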